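{- For $m\ge1$ let $c_m=\prod_{i=1}^{m-1}(2i-1)$ (so $c_1=1$), and for $l\ge1$ and integers $r$ let $C_{l,r}=\sum_{\pi}\prod_{B\in\pi}c_{|B|}$, the sum over all partitions $\pi$ of $\{1,\dots,l\}$ into exactly $r$ nonempty blocks (so $C_{l,r}=0$ if $r<1$ or $r>l$). Then $C_{1,1}=1$ and for $l\ge2$ and $1\le r\le l$, \[ C_{l,r}=(2l-r-2)\,C_{l-1,r}+C_{l-1,r-1}. \] -}

module Defs where

open import Data.Nat using (ℕ; zero; suc; _+_; _*_; _∸_; _⊔_; _≤ᵇ_; _≡ᵇ_)
open import Data.Bool using (Bool; true; false; _∧_)
open import Data.List using (List; []; _∷_; _++_; [_]; map; concatMap; upTo; length; filterᵇ)
open import Data.Nat.ListAction using (sum; product)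

-- c m = ∏_{i=1}^{m-1} (2i-1)   (for m ≥ 1; c 0 is never used, set to 1)
c : ℕ → ℕ
c zero = 1
c (suc zero) = 1
c (suc (suc k)) = (2 * suc k ∸ 1) * c (suc k)

-- All labelings  {1..l} → {0..r-1}, as lists of length l (position i = element i+1).
allLabelings : ℕ → ℕ → List (List ℕ)
allLabelings zero r = [] ∷ []
allLabelings (suc l) r = concatMap (λ v → map (λ a → v ++ [ a ]) (upTo r)) (allLabelings l r)

-- Restricted-growth check: scanning left to right with u = number of block labels
-- used so far, each label a must satisfy a ≤ u (a new block gets the next label u).
rgsFrom : ℕ → List ℕ → Bool
rgsFromCount : ℕ → List ℕ → ℕ
rgsFrom u [] = true
rgsFrom u (a ∷ as) = (a ≤ᵇ u) ∧ rgsFrom (u ⊔ suc a) as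
rgsFromCount u [] = u
rgsFromCount u (a ∷ as) = rgsFromCount (u ⊔ suc a) as

-- A labeling encodes a partition into exactly r blocks (canonically: blocks
-- numbered 0,1,...,r-1 in order of their least element).
isPartition : ℕ → List ℕ → Bool
isPartition r f = rgsFrom 0 f ∧ (rgsFromCount 0 f ≡ᵇ r)

partitions : ℕ → ℕ → List (List ℕ)
partitions l r = filterᵇ (isPartition r) (allLabelings l r)

blockSize : List ℕ → ℕ → ℕ
blockSize f k = length (filterᵇ (λ a → a ≡ᵇ k) f)

weight : ℕ → List ℕ → ℕ
weight r f = product (map (λ k → c (blockSize f k)) (upTo r))

C : ℕ → ℕ → ℕ
C l r = sum (map (weight r) (partitions l r))

-- Encode a partition of {1..l} into r blocks by its restricted growth string
-- and split off the last element l. Either l is a singleton block, and removing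
-- it leaves a partition into r − 1 blocks of the same weight (c₁ = 1), or l joins
-- a block B of a partition of {1..l−1} into r blocks, multiplying the weight by
-- c_{|B|+1} / c_{|B|} = 2|B| − 1. Summed over the r blocks, Σ (2|B| − 1) = 2(l − 1) − r.
module Submission where

open import Defs
open import Data.Nat using (ℕ; zero; suc; _+_; _*_; _∸_; _≤_; _<_; _⊔_; _≤ᵇ_; _≡ᵇ_; z≤n; z<s)
open import Data.Nat.Properties
open import Algebra.Properties.CommutativeSemigroup +-commutativeSemigroup using (interchange)
open import Algebra.Properties.CommutativeSemigroup *-commutativeSemigroup using (x∙yz≈y∙xz)
open import Data.Bool using (Bool; true; false; _∧_; if_then_else_; T)
open import Data.Bool.Properties using (∧-assoc; ∧-identityʳ; T-∧; T-≡)
open import Data.List using (List; []; _∷_; _++_; [_]; map; concatMap; upTo; length; filterᵇ)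
open import Data.List.Properties using (map-++; map-∘; map-cong; ++-assoc; length-++; upTo-∷ʳ)
open import Data.List.Relation.Unary.All using (All; []; _∷_)
open import Data.List.Relation.Unary.Any using (here; there)
open import Data.List.Membership.Propositional using (_∈_)
open import Data.Nat.ListAction using (sum; product)
open import Data.Nat.ListAction.Properties using (sum-++; product-++)
open import Data.Product using (_×_; _,_; proj₁; proj₂)
open import Data.Sum using (_⊎_; inj₁; inj₂; [_,_]′)
open import Function using (_∘_; Equivalence)
open import Relation.Nullary using (¬_; yes; no; contradiction)
open import Relation.Nullary.Decidable using (T?; dec-true; dec-false)
open import Relation.Binary using (tri<; tri≈; tri>)
open import Relation.Binary.PropositionalEquality
  using (_≡_; _≢_; refl; sym; trans; cong; cong₂; subst; ≢-sym; module ≡-Reasoning)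
open ≡-Reasoning

-- Sums and products over ranges

∑< : ℕ → (ℕ → ℕ) → ℕ
∑< zero    f = 0
∑< (suc n) f = ∑< n f + f n

∏< : ℕ → (ℕ → ℕ) → ℕ
∏< zero    f = 1
∏< (suc n) f = ∏< n f * f n

syntax ∑< n (λ a → e) = ∑[ a < n ] e
syntax ∏< n (λ a → e) = ∏[ a < n ] e

sum-map-upTo : ∀ n (f : ℕ → ℕ) → sum (map f (upTo n)) ≡ ∑< n f
sum-map-upTo zero    f = refl
sum-map-upTo (suc n) f = begin
  sum (map f (upTo (suc n)))       ≡⟨ cong (sum ∘ map f) (upTo-∷ʳ n) ⟨
  sum (map f (upTo n ++ [ n ]))    ≡⟨ cong sum (map-++ f (upTo n) [ n ]) ⟩
  sum (map f (upTo n) ++ [ f n ])  ≡⟨ sum-++ (map f (upTo n)) [ f n ] ⟩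
  sum (map f (upTo n)) + (f n + 0) ≡⟨ cong₂ _+_ (sum-map-upTo n f) (+-identityʳ (f n)) ⟩
  ∑< n f + f n                     ∎

product-map-upTo : ∀ n (f : ℕ → ℕ) → product (map f (upTo n)) ≡ ∏< n f
product-map-upTo zero    f = refl
product-map-upTo (suc n) f = begin
  product (map f (upTo (suc n)))         ≡⟨ cong (product ∘ map f) (upTo-∷ʳ n) ⟨
  product (map f (upTo n ++ [ n ]))      ≡⟨ cong product (map-++ f (upTo n) [ n ]) ⟩
  product (map f (upTo n) ++ [ f n ])    ≡⟨ product-++ (map f (upTo n)) [ f n ] ⟩
  product (map f (upTo n)) * (f n * 1)   ≡⟨ cong₂ _*_ (product-map-upTo n f) (*-identityʳ (f n)) ⟩
  ∏< n f * f n                           ∎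

∑<-cong : ∀ n {f g : ℕ → ℕ} → (∀ a → a < n → f a ≡ g a) → ∑< n f ≡ ∑< n g
∑<-cong zero    f≡g = refl
∑<-cong (suc n) f≡g = cong₂ _+_ (∑<-cong n (λ a a<n → f≡g a (m<n⇒m<1+n a<n))) (f≡g n ≤-refl)

∏<-cong : ∀ n {f g : ℕ → ℕ} → (∀ a → a < n → f a ≡ g a) → ∏< n f ≡ ∏< n g
∏<-cong zero    f≡g = refl
∏<-cong (suc n) f≡g = cong₂ _*_ (∏<-cong n (λ a a<n → f≡g a (m<n⇒m<1+n a<n))) (f≡g n ≤-refl)

∑<-zero : ∀ n {f : ℕ → ℕ} → (∀ a → a < n → f a ≡ 0) → ∑< n f ≡ 0
∑<-zero zero    f≡0 = refl
∑<-zero (suc n) f≡0 = cong₂ _+_ (∑<-zero n (λ a a<n → f≡0 a (m<n⇒m<1+n a<n))) (f≡0 n ≤-refl)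

∑<-one : ∀ n → ∑[ a < n ] 1 ≡ n
∑<-one zero    = refl
∑<-one (suc n) = trans (+-comm (∑[ a < n ] 1) 1) (cong suc (∑<-one n))

∑<-distrib-+ : ∀ n (f g : ℕ → ℕ) → ∑[ a < n ] (f a + g a) ≡ ∑< n f + ∑< n g
∑<-distrib-+ zero    f g = refl
∑<-distrib-+ (suc n) f g =
  trans (cong (_+ (f n + g n)) (∑<-distrib-+ n f g)) (interchange (∑< n f) (∑< n g) (f n) (g n))

∑<-distribˡ-* : ∀ n (f : ℕ → ℕ) w → ∑[ a < n ] (w * f a) ≡ w * ∑< n f
∑<-distribˡ-* zero    f w = sym (*-zeroʳ w)
∑<-distribˡ-* (suc n) f w =
  trans (cong (_+ w * f n) (∑<-distribˡ-* n f w)) (sym (*-distribˡ-+ w (∑< n f) (f n)))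

∑<-distribʳ-* : ∀ n (f : ℕ → ℕ) w → ∑[ a < n ] (f a * w) ≡ ∑< n f * w
∑<-distribʳ-* zero    f w = refl
∑<-distribʳ-* (suc n) f w =
  trans (cong (_+ f n * w) (∑<-distribʳ-* n f w)) (sym (*-distribʳ-+ w (∑< n f) (f n)))

∑<-truncate : ∀ {r} R {f : ℕ → ℕ} → r ≤ R → (∀ a → r ≤ a → f a ≡ 0) → ∑< R f ≡ ∑< r f
∑<-truncate zero    z≤n     _   = refl
∑<-truncate (suc R) r≤1+R f≡0 with m≤n⇒m<n∨m≡n r≤1+R
... | inj₂ refl  = refl
... | inj₁ r<1+R = trans (cong₂ _+_ (∑<-truncate R r≤R f≡0) (f≡0 R r≤R)) (+-identityʳ _)
  where r≤R = ≤-pred r<1+R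

∑<-incrementAt : ∀ n {f g : ℕ → ℕ} x → x < n → f x ≡ suc (g x) →
                 (∀ a → a < n → a ≢ x → f a ≡ g a) → ∑< n f ≡ suc (∑< n g)
∑<-incrementAt (suc n) {f} {g} x x<1+n fx≡1+gx fa≡ga with x ≟ n
... | yes refl = begin
  ∑< x f + f x           ≡⟨ cong₂ _+_ (∑<-cong x (λ a a<x → fa≡ga a (m<n⇒m<1+n a<x) (<⇒≢ a<x))) fx≡1+gx ⟩
  ∑< x g + suc (g x)     ≡⟨ +-suc (∑< x g) (g x) ⟩
  suc (∑< x g + g x)     ∎
... | no x≢n = cong₂ _+_ (∑<-incrementAt n x x<n fx≡1+gx (λ a a<n → fa≡ga a (m<n⇒m<1+n a<n)))
                         (fa≡ga n ≤-refl (≢-sym x≢n))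
  where x<n = ≤∧≢⇒< (≤-pred x<1+n) x≢n

∏<-scaleAt : ∀ n {f g : ℕ → ℕ} x w → x < n → f x ≡ w * g x →
             (∀ a → a < n → a ≢ x → f a ≡ g a) → ∏< n f ≡ w * ∏< n g
∏<-scaleAt (suc n) {f} {g} x w x<1+n fx≡wgx fa≡ga with x ≟ n
... | yes refl = begin
  ∏< x f * f x           ≡⟨ cong₂ _*_ (∏<-cong x (λ a a<x → fa≡ga a (m<n⇒m<1+n a<x) (<⇒≢ a<x))) fx≡wgx ⟩
  ∏< x g * (w * g x)     ≡⟨ x∙yz≈y∙xz (∏< x g) w (g x) ⟩
  w * (∏< x g * g x)     ∎
... | no x≢n = begin
  ∏< n f * f n           ≡⟨ cong₂ _*_ (∏<-scaleAt n x w x<n fx≡wgx (λ a a<n → fa≡ga a (m<n⇒m<1+n a<n)))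
                                      (fa≡ga n ≤-refl (≢-sym x≢n)) ⟩
  w * ∏< n g * g n       ≡⟨ *-assoc w (∏< n g) (g n) ⟩
  w * (∏< n g * g n)     ∎
  where x<n = ≤∧≢⇒< (≤-pred x<1+n) x≢n

∑<-double-pred : ∀ n (s : ℕ → ℕ) → (∀ a → a < n → 0 < s a) → ∑[ a < n ] (2 * s a ∸ 1) ≡ 2 * ∑< n s ∸ n
∑<-double-pred n s s>0 = begin
  ∑[ a < n ] (2 * s a ∸ 1)          ≡⟨ m+n∸n≡m _ n ⟨
  ∑[ a < n ] (2 * s a ∸ 1) + n ∸ n  ≡⟨ cong (_∸ n) plus-n ⟩
  2 * ∑< n s ∸ n                    ∎
  where
  plus-n : ∑[ a < n ] (2 * s a ∸ 1) + n ≡ 2 * ∑< n s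
  plus-n = begin
    ∑[ a < n ] (2 * s a ∸ 1) + n              ≡⟨ cong (∑[ a < n ] (2 * s a ∸ 1) +_) (∑<-one n) ⟨
    ∑[ a < n ] (2 * s a ∸ 1) + ∑[ a < n ] 1   ≡⟨ ∑<-distrib-+ n (λ a → 2 * s a ∸ 1) (λ _ → 1) ⟨
    ∑[ a < n ] (2 * s a ∸ 1 + 1)              ≡⟨ ∑<-cong n (λ a a<n → m∸n+n≡m (≤-trans (s>0 a a<n) (m≤m+n (s a) _))) ⟩
    ∑[ a < n ] (2 * s a)                      ≡⟨ ∑<-distribˡ-* n s 2 ⟩
    2 * ∑< n s                                ∎

-- Block sizes and weights

blockSize-∷-≡ : ∀ x v → blockSize (x ∷ v) x ≡ suc (blockSize v x)
blockSize-∷-≡ x v rewrite dec-true (x ≟ x) refl = refl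

blockSize-∷-≢ : ∀ {x k} v → x ≢ k → blockSize (x ∷ v) k ≡ blockSize v k
blockSize-∷-≢ {x} {k} v x≢k rewrite dec-false (x ≟ k) x≢k = refl

blockSize-∷ʳ-≡ : ∀ v a → blockSize (v ++ [ a ]) a ≡ suc (blockSize v a)
blockSize-∷ʳ-≡ []      a = blockSize-∷-≡ a []
blockSize-∷ʳ-≡ (x ∷ v) a with x ≡ᵇ a
... | true  = cong suc (blockSize-∷ʳ-≡ v a)
... | false = blockSize-∷ʳ-≡ v a

blockSize-∷ʳ-≢ : ∀ v {a k} → a ≢ k → blockSize (v ++ [ a ]) k ≡ blockSize v k
blockSize-∷ʳ-≢ []      a≢k = blockSize-∷-≢ [] a≢k
blockSize-∷ʳ-≢ (x ∷ v) {k = k} a≢k with x ≡ᵇ k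
... | true  = cong suc (blockSize-∷ʳ-≢ v a≢k)
... | false = blockSize-∷ʳ-≢ v a≢k

blockSize-unused : ∀ {n k} v → All (_< n) v → n ≤ k → blockSize v k ≡ 0
blockSize-unused []      []          _   = refl
blockSize-unused (x ∷ v) (x<n ∷ v<n) n≤k =
  trans (blockSize-∷-≢ v (<⇒≢ (<-≤-trans x<n n≤k))) (blockSize-unused v v<n n≤k)

∈⇒0<blockSize : ∀ {a v} → a ∈ v → 0 < blockSize v a
∈⇒0<blockSize {a} {x ∷ v} a∈x∷v with x ≟ a | a∈x∷v
... | yes refl | _         = subst (0 <_) (sym (blockSize-∷-≡ x v)) z<s
... | no x≢a   | here a≡x  = contradiction (sym a≡x) x≢a
... | no x≢a   | there a∈v = subst (0 <_) (sym (blockSize-∷-≢ v x≢a)) (∈⇒0<blockSize a∈v)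

∑<-blockSize : ∀ r {v} → All (_< r) v → ∑[ a < r ] blockSize v a ≡ length v
∑<-blockSize r {[]}    []          = ∑<-zero r (λ _ _ → refl)
∑<-blockSize r {x ∷ v} (x<r ∷ v<r) = trans
  (∑<-incrementAt r x x<r (blockSize-∷-≡ x v) (λ a _ a≢x → blockSize-∷-≢ v (≢-sym a≢x)))
  (cong suc (∑<-blockSize r v<r))

c-suc : ∀ {s} → 0 < s → c (suc s) ≡ (2 * s ∸ 1) * c s
c-suc {suc s} _ = refl

weight≡∏< : ∀ r v → weight r v ≡ ∏[ j < r ] c (blockSize v j)
weight≡∏< r v = product-map-upTo r (λ j → c (blockSize v j))

weight-∷ʳ-join : ∀ {r} v {a} → a < r → 0 < blockSize v a →
                weight r (v ++ [ a ]) ≡ (2 * blockSize v a ∸ 1) * weight r v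
weight-∷ʳ-join {r} v {a} a<r occupied = begin
  weight r (v ++ [ a ])                                  ≡⟨ weight≡∏< r (v ++ [ a ]) ⟩
  ∏[ j < r ] c (blockSize (v ++ [ a ]) j)                ≡⟨ ∏<-scaleAt r a (2 * blockSize v a ∸ 1) a<r grown unchanged ⟩
  (2 * blockSize v a ∸ 1) * ∏[ j < r ] c (blockSize v j) ≡⟨ cong ((2 * blockSize v a ∸ 1) *_) (weight≡∏< r v) ⟨
  (2 * blockSize v a ∸ 1) * weight r v                   ∎
  where
  grown : c (blockSize (v ++ [ a ]) a) ≡ (2 * blockSize v a ∸ 1) * c (blockSize v a)
  grown = trans (cong c (blockSize-∷ʳ-≡ v a)) (c-suc occupied)
  unchanged : ∀ j → j < r → j ≢ a → c (blockSize (v ++ [ a ]) j) ≡ c (blockSize v j)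
  unchanged j _ j≢a = cong c (blockSize-∷ʳ-≢ v (≢-sym j≢a))

weight-∷ʳ-open : ∀ v {k} → blockSize v k ≡ 0 → weight (suc k) (v ++ [ k ]) ≡ weight k v
weight-∷ʳ-open v {k} unused = begin
  weight (suc k) (v ++ [ k ])                                              ≡⟨ weight≡∏< (suc k) (v ++ [ k ]) ⟩
  ∏[ j < k ] c (blockSize (v ++ [ k ]) j) * c (blockSize (v ++ [ k ]) k)   ≡⟨ cong₂ _*_ unchanged singleton ⟩
  ∏[ j < k ] c (blockSize v j) * 1                                         ≡⟨ *-identityʳ _ ⟩
  ∏[ j < k ] c (blockSize v j)                                             ≡⟨ weight≡∏< k v ⟨
  weight k v                                                               ∎
  where
  unchanged : ∏[ j < k ] c (blockSize (v ++ [ k ]) j) ≡ ∏[ j < k ] c (blockSize v j)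
  unchanged = ∏<-cong k (λ j j<k → cong c (blockSize-∷ʳ-≢ v (>⇒≢ j<k)))
  singleton : c (blockSize (v ++ [ k ]) k) ≡ 1
  singleton = cong c (trans (blockSize-∷ʳ-≡ v k) (cong suc unused))

-- Restricted growth strings

blocks : List ℕ → ℕ
blocks = rgsFromCount 0

rgsFromCount-++ : ∀ u xs ys → rgsFromCount u (xs ++ ys) ≡ rgsFromCount (rgsFromCount u xs) ys
rgsFromCount-++ u []       ys = refl
rgsFromCount-++ u (x ∷ xs) ys = rgsFromCount-++ (u ⊔ suc x) xs ys

rgsFrom-∷ʳ : ∀ u xs a → rgsFrom u (xs ++ [ a ]) ≡ rgsFrom u xs ∧ (a ≤ᵇ rgsFromCount u xs)
rgsFrom-∷ʳ u []       a = ∧-identityʳ (a ≤ᵇ u)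
rgsFrom-∷ʳ u (x ∷ xs) a =
  trans (cong ((x ≤ᵇ u) ∧_) (rgsFrom-∷ʳ (u ⊔ suc x) xs a)) (sym (∧-assoc (x ≤ᵇ u) _ _))

rgsFrom-∷ʳ⇒≤ : ∀ u xs {a} → T (rgsFrom u (xs ++ [ a ])) → a ≤ rgsFromCount u xs
rgsFrom-∷ʳ⇒≤ u xs {a} rgs =
  ≤ᵇ⇒≤ a _ (proj₂ (Equivalence.to (T-∧ {rgsFrom u xs}) (subst T (rgsFrom-∷ʳ u xs a) rgs)))

≤-rgsFromCount : ∀ u xs → u ≤ rgsFromCount u xs
≤-rgsFromCount u []       = ≤-refl
≤-rgsFromCount u (x ∷ xs) = ≤-trans (m≤m⊔n u (suc x)) (≤-rgsFromCount (u ⊔ suc x) xs)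

label<rgsFromCount : ∀ u xs a ys → a < rgsFromCount u (xs ++ a ∷ ys)
label<rgsFromCount u xs a ys = subst (a <_) (sym (rgsFromCount-++ u xs (a ∷ ys)))
  (≤-trans (m≤n⊔m (rgsFromCount u xs) (suc a)) (≤-rgsFromCount _ ys))

labels<rgsFromCount : ∀ u xs → All (_< rgsFromCount u xs) xs
labels<rgsFromCount u []       = []
labels<rgsFromCount u (x ∷ xs) =
  ≤-trans (m≤n⊔m u (suc x)) (≤-rgsFromCount _ xs) ∷ labels<rgsFromCount (u ⊔ suc x) xs

rgsFrom-∈ : ∀ {u} v → T (rgsFrom u v) → ∀ {a} → u ≤ a → a < rgsFromCount u v → a ∈ v
rgsFrom-∈ []      _   u≤a a<u = contradiction u≤a (<⇒≱ a<u)
rgsFrom-∈ {u} (x ∷ v) rgs {a} u≤a a<count with x ≟ a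
... | yes refl = here refl
... | no x≢a   = there (rgsFrom-∈ v (proj₂ x≤u×rgs) (⊔-lub u≤a x<a) a<count)
  where
  x≤u×rgs = Equivalence.to T-∧ rgs
  x<a = ≤∧≢⇒< (≤-trans (≤ᵇ⇒≤ x u (proj₁ x≤u×rgs)) u≤a) x≢a

isPartition⇒rgsFrom : ∀ {r} v → T (isPartition r v) → T (rgsFrom 0 v)
isPartition⇒rgsFrom v p = proj₁ (Equivalence.to T-∧ p)

isPartition⇒blocks≡ : ∀ {r} v → T (isPartition r v) → blocks v ≡ r
isPartition⇒blocks≡ {r} v p = ≡ᵇ⇒≡ (blocks v) r (proj₂ (Equivalence.to T-∧ p))

isPartition-unique : ∀ {r s} v → T (isPartition r v) → T (isPartition s v) → r ≡ s
isPartition-unique v p q = trans (sym (isPartition⇒blocks≡ v p)) (isPartition⇒blocks≡ v q)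

isPartition⇒labels< : ∀ {r} v → T (isPartition r v) → All (_< r) v
isPartition⇒labels< v p = subst (λ n → All (_< n) v) (isPartition⇒blocks≡ v p) (labels<rgsFromCount 0 v)

isPartition⇒∈ : ∀ {r} v → T (isPartition r v) → ∀ {a} → a < r → a ∈ v
isPartition⇒∈ v p a<r =
  rgsFrom-∈ v (isPartition⇒rgsFrom v p) z≤n (subst (_ <_) (sym (isPartition⇒blocks≡ v p)) a<r)

isPartition-∷ʳ : ∀ r v a →
  isPartition r (v ++ [ a ]) ≡ (rgsFrom 0 v ∧ (a ≤ᵇ blocks v)) ∧ ((blocks v ⊔ suc a) ≡ᵇ r)
isPartition-∷ʳ r v a = cong₂ (λ b n → b ∧ (n ≡ᵇ r)) (rgsFrom-∷ʳ 0 v a) (rgsFromCount-++ 0 v [ a ])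

isPartition-∷ʳ-join : ∀ r v {a} → a < blocks v → isPartition r (v ++ [ a ]) ≡ isPartition r v
isPartition-∷ʳ-join r v {a} a<n = trans (isPartition-∷ʳ r v a) (cong₂ (λ b n → b ∧ (n ≡ᵇ r))
  (trans (cong (rgsFrom 0 v ∧_) (dec-true (a ≤? blocks v) (<⇒≤ a<n))) (∧-identityʳ _))
  (m≥n⇒m⊔n≡m a<n))

isPartition-∷ʳ-open : ∀ k v → isPartition (suc k) (v ++ [ blocks v ]) ≡ isPartition k v
isPartition-∷ʳ-open k v = trans (isPartition-∷ʳ (suc k) v (blocks v)) (cong₂ (λ b n → b ∧ (n ≡ᵇ suc k))
  (trans (cong (rgsFrom 0 v ∧_) (dec-true (blocks v ≤? blocks v) ≤-refl)) (∧-identityʳ _))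
  (m≤n⇒m⊔n≡n (n≤1+n (blocks v))))

isPartition-∷ʳ-gap : ∀ r v {a} → blocks v < a → ¬ T (isPartition r (v ++ [ a ]))
isPartition-∷ʳ-gap r v n<a p = <⇒≱ n<a (rgsFrom-∷ʳ⇒≤ 0 v (isPartition⇒rgsFrom (v ++ [ _ ]) p))

isPartition-∷ʳ⁻ : ∀ k v {a} → T (isPartition (suc k) (v ++ [ a ])) → T (isPartition (suc k) v) ⊎ T (isPartition k v)
isPartition-∷ʳ⁻ k v {a} p with <-cmp a (blocks v)
... | tri< a<n _ _ = inj₁ (subst T (isPartition-∷ʳ-join (suc k) v a<n) p)
... | tri≈ _ refl _ = inj₂ (subst T (isPartition-∷ʳ-open k v) p)
... | tri> _ _ n<a = contradiction p (isPartition-∷ʳ-gap (suc k) v n<a)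

-- Appending an element to a partition

partitionWeight : ℕ → List ℕ → ℕ
partitionWeight r v = if isPartition r v then weight r v else 0

partitionWeight-yes : ∀ r v → T (isPartition r v) → partitionWeight r v ≡ weight r v
partitionWeight-yes r v p = cong (λ b → if b then weight r v else 0) (Equivalence.to T-≡ p)

partitionWeight-no : ∀ r v → ¬ T (isPartition r v) → partitionWeight r v ≡ 0
partitionWeight-no r v ¬p with isPartition r v
... | true  = contradiction _ ¬p
... | false = refl

partitionWeight-label≥ : ∀ {r} xs ys {a} → r ≤ a → partitionWeight r (xs ++ a ∷ ys) ≡ 0
partitionWeight-label≥ {r} xs ys {a} r≤a = partitionWeight-no r (xs ++ a ∷ ys) λ p →
  <⇒≢ (≤-<-trans r≤a (label<rgsFromCount 0 xs a ys)) (sym (isPartition⇒blocks≡ (xs ++ a ∷ ys) p))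

partitionWeight-∷ʳ-join : ∀ r v {a} → a < blocks v →
  partitionWeight r (v ++ [ a ]) ≡ (2 * blockSize v a ∸ 1) * partitionWeight r v
partitionWeight-∷ʳ-join r v {a} a<n with T? (isPartition r v)
... | yes p = begin
  partitionWeight r (v ++ [ a ])                ≡⟨ partitionWeight-yes r (v ++ [ a ]) p′ ⟩
  weight r (v ++ [ a ])                         ≡⟨ weight-∷ʳ-join v a<r (∈⇒0<blockSize (isPartition⇒∈ v p a<r)) ⟩
  (2 * blockSize v a ∸ 1) * weight r v          ≡⟨ cong ((2 * blockSize v a ∸ 1) *_) (partitionWeight-yes r v p) ⟨
  (2 * blockSize v a ∸ 1) * partitionWeight r v ∎
  where
  p′ = subst T (sym (isPartition-∷ʳ-join r v a<n)) p
  a<r = subst (a <_) (isPartition⇒blocks≡ v p) a<n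
... | no ¬p = begin
  partitionWeight r (v ++ [ a ])
    ≡⟨ partitionWeight-no r (v ++ [ a ]) (¬p ∘ subst T (isPartition-∷ʳ-join r v a<n)) ⟩
  0                                             ≡⟨ *-zeroʳ (2 * blockSize v a ∸ 1) ⟨
  (2 * blockSize v a ∸ 1) * 0                   ≡⟨ cong ((2 * blockSize v a ∸ 1) *_) (partitionWeight-no r v ¬p) ⟨
  (2 * blockSize v a ∸ 1) * partitionWeight r v ∎

partitionWeight-∷ʳ-open : ∀ k v → partitionWeight (suc k) (v ++ [ blocks v ]) ≡ partitionWeight k v
partitionWeight-∷ʳ-open k v with T? (isPartition k v)
... | yes q = begin
  partitionWeight (suc k) (v ++ [ blocks v ]) ≡⟨ partitionWeight-yes (suc k) (v ++ [ blocks v ]) q′ ⟩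
  weight (suc k) (v ++ [ blocks v ])          ≡⟨ cong (λ n → weight (suc k) (v ++ [ n ])) n≡k ⟩
  weight (suc k) (v ++ [ k ])                 ≡⟨ weight-∷ʳ-open v (blockSize-unused v (isPartition⇒labels< v q) ≤-refl) ⟩
  weight k v                                  ≡⟨ partitionWeight-yes k v q ⟨
  partitionWeight k v                         ∎
  where
  q′ = subst T (sym (isPartition-∷ʳ-open k v)) q
  n≡k = isPartition⇒blocks≡ v q
... | no ¬q = trans (partitionWeight-no (suc k) (v ++ [ blocks v ]) (¬q ∘ subst T (isPartition-∷ʳ-open k v)))
  (sym (partitionWeight-no k v ¬q))

∑<-oddBlockSizes : ∀ {r} v → T (isPartition r v) → ∑[ a < r ] (2 * blockSize v a ∸ 1) ≡ 2 * length v ∸ r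
∑<-oddBlockSizes {r} v p = begin
  ∑[ a < r ] (2 * blockSize v a ∸ 1) ≡⟨ ∑<-double-pred r (blockSize v) (λ _ → ∈⇒0<blockSize ∘ isPartition⇒∈ v p) ⟩
  2 * ∑[ a < r ] blockSize v a ∸ r   ≡⟨ cong (λ s → 2 * s ∸ r) (∑<-blockSize r (isPartition⇒labels< v p)) ⟩
  2 * length v ∸ r                   ∎

∑<-extensions-join : ∀ {r} v → T (isPartition r v) →
  ∑[ a < r ] partitionWeight r (v ++ [ a ]) ≡ (2 * length v ∸ r) * partitionWeight r v
∑<-extensions-join {r} v p = begin
  ∑[ a < r ] partitionWeight r (v ++ [ a ])                   ≡⟨ ∑<-cong r joins ⟩
  ∑[ a < r ] ((2 * blockSize v a ∸ 1) * partitionWeight r v)  ≡⟨ ∑<-distribʳ-* r (λ a → 2 * blockSize v a ∸ 1) _ ⟩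
  ∑[ a < r ] (2 * blockSize v a ∸ 1) * partitionWeight r v    ≡⟨ cong (_* partitionWeight r v) (∑<-oddBlockSizes v p) ⟩
  (2 * length v ∸ r) * partitionWeight r v                    ∎
  where
  joins : ∀ a → a < r → partitionWeight r (v ++ [ a ]) ≡ (2 * blockSize v a ∸ 1) * partitionWeight r v
  joins a a<r = partitionWeight-∷ʳ-join r v (subst (a <_) (sym (isPartition⇒blocks≡ v p)) a<r)

∑<-extensions-open : ∀ {k} v → T (isPartition k v) →
  ∑[ a < suc k ] partitionWeight (suc k) (v ++ [ a ]) ≡ partitionWeight k v
∑<-extensions-open {k} v q = cong₂ _+_ (∑<-zero k joins) opens
  where
  n≡k = isPartition⇒blocks≡ v q
  ¬p : ¬ T (isPartition (suc k) v)
  ¬p p = <⇒≢ (n<1+n k) (isPartition-unique v q p)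
  joins : ∀ a → a < k → partitionWeight (suc k) (v ++ [ a ]) ≡ 0
  joins a a<k = partitionWeight-no (suc k) (v ++ [ a ])
    (¬p ∘ subst T (isPartition-∷ʳ-join (suc k) v (subst (a <_) (sym n≡k) a<k)))
  opens : partitionWeight (suc k) (v ++ [ k ]) ≡ partitionWeight k v
  opens = trans (cong (λ n → partitionWeight (suc k) (v ++ [ n ])) (sym n≡k)) (partitionWeight-∷ʳ-open k v)

∑<-extensions-none : ∀ {k} v → ¬ T (isPartition (suc k) v) → ¬ T (isPartition k v) →
  ∑[ a < suc k ] partitionWeight (suc k) (v ++ [ a ]) ≡ 0
∑<-extensions-none {k} v ¬p ¬q =
  ∑<-zero (suc k) (λ a _ → partitionWeight-no (suc k) (v ++ [ a ]) ([ ¬p , ¬q ]′ ∘ isPartition-∷ʳ⁻ k v))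

∑<-extensions : ∀ k v → ∑[ a < suc k ] partitionWeight (suc k) (v ++ [ a ])
                      ≡ (2 * length v ∸ suc k) * partitionWeight (suc k) v + partitionWeight k v
∑<-extensions k v with T? (isPartition (suc k) v) | T? (isPartition k v)
... | yes p | yes q = contradiction (isPartition-unique v q p) (<⇒≢ (n<1+n k))
... | yes p | no ¬q = begin
  ∑[ a < suc k ] partitionWeight (suc k) (v ++ [ a ])   ≡⟨ ∑<-extensions-join v p ⟩
  K * partitionWeight (suc k) v                         ≡⟨ +-identityʳ _ ⟨
  K * partitionWeight (suc k) v + 0                     ≡⟨ cong (K * partitionWeight (suc k) v +_) (partitionWeight-no k v ¬q) ⟨
  K * partitionWeight (suc k) v + partitionWeight k v   ∎
  where K = 2 * length v ∸ suc k
... | no ¬p | yes q = begin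
  ∑[ a < suc k ] partitionWeight (suc k) (v ++ [ a ])   ≡⟨ ∑<-extensions-open v q ⟩
  partitionWeight k v                                   ≡⟨ cong (_+ partitionWeight k v) (*-zeroʳ K) ⟨
  K * 0 + partitionWeight k v                           ≡⟨ cong (λ w → K * w + partitionWeight k v) (partitionWeight-no (suc k) v ¬p) ⟨
  K * partitionWeight (suc k) v + partitionWeight k v   ∎
  where K = 2 * length v ∸ suc k
... | no ¬p | no ¬q = begin
  ∑[ a < suc k ] partitionWeight (suc k) (v ++ [ a ])   ≡⟨ ∑<-extensions-none v ¬p ¬q ⟩
  0                                                     ≡⟨ cong (_+ 0) (*-zeroʳ K) ⟨
  K * 0 + 0                                             ≡⟨ cong₂ (λ w w′ → K * w + w′) (partitionWeight-no (suc k) v ¬p) (partitionWeight-no k v ¬q) ⟨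
  K * partitionWeight (suc k) v + partitionWeight k v   ∎
  where K = 2 * length v ∸ suc k

-- Sums over all labelings

sum-map-filterᵇ : ∀ {A : Set} (p : A → Bool) (g : A → ℕ) xs →
  sum (map g (filterᵇ p xs)) ≡ sum (map (λ x → if p x then g x else 0) xs)
sum-map-filterᵇ p g []       = refl
sum-map-filterᵇ p g (x ∷ xs) with p x
... | true  = cong (g x +_) (sum-map-filterᵇ p g xs)
... | false = sum-map-filterᵇ p g xs

sum-map-concatMap : ∀ {A B : Set} (g : B → ℕ) (f : A → List B) xs →
  sum (map g (concatMap f xs)) ≡ sum (map (λ x → sum (map g (f x))) xs)
sum-map-concatMap g f []       = refl
sum-map-concatMap g f (x ∷ xs) = begin
  sum (map g (f x ++ concatMap f xs))              ≡⟨ cong sum (map-++ g (f x) (concatMap f xs)) ⟩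
  sum (map g (f x) ++ map g (concatMap f xs))      ≡⟨ sum-++ (map g (f x)) _ ⟩
  sum (map g (f x)) + sum (map g (concatMap f xs)) ≡⟨ cong (sum (map g (f x)) +_) (sum-map-concatMap g f xs) ⟩
  sum (map g (f x)) + sum (map (λ x → sum (map g (f x))) xs) ∎

sum-map-linear : ∀ {A : Set} k (f g : A → ℕ) xs →
  sum (map (λ x → k * f x + g x) xs) ≡ k * sum (map f xs) + sum (map g xs)
sum-map-linear k f g []       = sym (trans (+-identityʳ (k * 0)) (*-zeroʳ k))
sum-map-linear k f g (x ∷ xs) = begin
  (k * f x + g x) + sum (map (λ x → k * f x + g x) xs) ≡⟨ cong ((k * f x + g x) +_) (sum-map-linear k f g xs) ⟩
  (k * f x + g x) + (k * F + G)                        ≡⟨ interchange (k * f x) (g x) (k * F) G ⟩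
  (k * f x + k * F) + (g x + G)                        ≡⟨ cong (_+ (g x + G)) (*-distribˡ-+ k (f x) F) ⟨
  k * (f x + F) + (g x + G)                            ∎
  where
  F = sum (map f xs)
  G = sum (map g xs)

sum-allLabelings-suc : ∀ l R (g : List ℕ → ℕ) →
  sum (map g (allLabelings (suc l) R)) ≡ sum (map (λ v → ∑[ a < R ] g (v ++ [ a ])) (allLabelings l R))
sum-allLabelings-suc l R g = trans (sum-map-concatMap g _ (allLabelings l R))
  (cong sum (map-cong (λ v → trans (cong sum (sym (map-∘ (upTo R)))) (sum-map-upTo R (λ a → g (v ++ [ a ]))))
                      (allLabelings l R)))

sum-allLabelings-cong : ∀ l R {f g : List ℕ → ℕ} → (∀ v → length v ≡ l → f v ≡ g v) →
  sum (map f (allLabelings l R)) ≡ sum (map g (allLabelings l R))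
sum-allLabelings-cong zero    R f≡g = cong (_+ 0) (f≡g [] refl)
sum-allLabelings-cong (suc l) R {f} {g} f≡g = begin
  sum (map f (allLabelings (suc l) R))                              ≡⟨ sum-allLabelings-suc l R f ⟩
  sum (map (λ v → ∑[ a < R ] f (v ++ [ a ])) (allLabelings l R))    ≡⟨ sum-allLabelings-cong l R extended ⟩
  sum (map (λ v → ∑[ a < R ] g (v ++ [ a ])) (allLabelings l R))    ≡⟨ sum-allLabelings-suc l R g ⟨
  sum (map g (allLabelings (suc l) R))                              ∎
  where
  extended : ∀ v → length v ≡ l → ∑[ a < R ] f (v ++ [ a ]) ≡ ∑[ a < R ] g (v ++ [ a ])
  extended v len = ∑<-cong R λ a _ → f≡g (v ++ [ a ])
    (trans (length-++ v) (trans (+-comm (length v) 1) (cong suc len)))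

sum-allLabelings-shrink : ∀ l {r R} (P : List ℕ → ℕ) → r ≤ R → (∀ xs ys {a} → r ≤ a → P (xs ++ a ∷ ys) ≡ 0) →
  sum (map P (allLabelings l R)) ≡ sum (map P (allLabelings l r))
sum-allLabelings-shrink zero    P r≤R P≡0 = refl
sum-allLabelings-shrink (suc l) {r} {R} P r≤R P≡0 = begin
  sum (map P (allLabelings (suc l) R))                           ≡⟨ sum-allLabelings-suc l R P ⟩
  sum (map (λ v → ∑[ a < R ] P (v ++ [ a ])) (allLabelings l R)) ≡⟨ cong sum (map-cong truncate (allLabelings l R)) ⟩
  sum (map Q (allLabelings l R))                                 ≡⟨ sum-allLabelings-shrink l Q r≤R Q≡0 ⟩
  sum (map Q (allLabelings l r))                                 ≡⟨ sum-allLabelings-suc l r P ⟨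
  sum (map P (allLabelings (suc l) r))                           ∎
  where
  Q : List ℕ → ℕ
  Q v = ∑[ a < r ] P (v ++ [ a ])
  truncate : ∀ v → ∑[ a < R ] P (v ++ [ a ]) ≡ Q v
  truncate v = ∑<-truncate R r≤R (λ a r≤a → P≡0 v [] r≤a)
  Q≡0 : ∀ xs ys {a} → r ≤ a → Q (xs ++ a ∷ ys) ≡ 0
  Q≡0 xs ys {a} r≤a = ∑<-zero r λ b _ → trans (cong P (++-assoc xs (a ∷ ys) [ b ])) (P≡0 xs (ys ++ [ b ]) r≤a)

C≡sum-partitionWeight : ∀ l r → C l r ≡ sum (map (partitionWeight r) (allLabelings l r))
C≡sum-partitionWeight l r = sum-map-filterᵇ (isPartition r) (weight r) (allLabelings l r)

C-recurrence : ∀ m k → C (suc m) (suc k) ≡ (2 * m ∸ suc k) * C m (suc k) + C m k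
C-recurrence m k = begin
  C (suc m) r                                                       ≡⟨ C≡sum-partitionWeight (suc m) r ⟩
  sum (map (partitionWeight r) (allLabelings (suc m) r))            ≡⟨ sum-allLabelings-suc m r (partitionWeight r) ⟩
  sum (map (λ v → ∑[ a < r ] partitionWeight r (v ++ [ a ])) (allLabelings m r))
    ≡⟨ sum-allLabelings-cong m r extensions ⟩
  sum (map (λ v → K * partitionWeight r v + partitionWeight k v) (allLabelings m r))
    ≡⟨ sum-map-linear K (partitionWeight r) (partitionWeight k) (allLabelings m r) ⟩
  K * S r r + S k r  ≡⟨ cong (K * S r r +_) (sum-allLabelings-shrink m (partitionWeight k) (n≤1+n k) partitionWeight-label≥) ⟩
  K * S r r + S k k  ≡⟨ cong₂ (λ x y → K * x + y) (C≡sum-partitionWeight m r) (C≡sum-partitionWeight m k) ⟨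
  K * C m r + C m k  ∎
  where
  r = suc k
  K = 2 * m ∸ r
  S : ℕ → ℕ → ℕ
  S q R = sum (map (partitionWeight q) (allLabelings m R))
  extensions : ∀ v → length v ≡ m →
    ∑[ a < r ] partitionWeight r (v ++ [ a ]) ≡ K * partitionWeight r v + partitionWeight k v
  extensions v len = trans (∑<-extensions k v)
    (cong (λ l → (2 * l ∸ r) * partitionWeight r v + partitionWeight k v) len)

lemma3 : (C 1 1 ≡ 1)
    × (∀ (l r : ℕ) → 2 ≤ l → 1 ≤ r → r ≤ l →
    C l r ≡ (2 * l ∸ r ∸ 2) * C (l ∸ 1) r + C (l ∸ 1) (r ∸ 1))
lemma3 = refl , recurrence
  where
  coefficient : ∀ m r → 2 * suc m ∸ r ∸ 2 ≡ 2 * m ∸ r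
  coefficient m r = trans (∸-+-assoc (2 * suc m) r 2) (cong₂ _∸_ (*-suc 2 m) (+-comm r 2))
  recurrence : ∀ l r → 2 ≤ l → 1 ≤ r → r ≤ l → C l r ≡ (2 * l ∸ r ∸ 2) * C (l ∸ 1) r + C (l ∸ 1) (r ∸ 1)
  recurrence (suc m) (suc k) _ _ _ =
    trans (C-recurrence m k) (cong (λ K → K * C m (suc k) + C m k) (sym (coefficient m (suc k))))
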